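{- Let $S=\{s_1,s_2\}$ be a set of two distinct nonempty binary strings such that the Seeker wins the Renyi-Ulam game with lie restriction $r(S)$. Then $s_1$ and $s_2$ have no common substring $p$ that is equal to $00$ or $11$ or has length at least three.
   Context: For a set $S$ of nonempty binary strings, $r(S)$ is the set of finite binary strings containing no element of $S$ as a contiguous substring. Renyi-Ulam game with lie restriction $R$: the Obscurer picks $x\in\{1,\dots,n\}$; each turn the Seeker asks whether $x$ lies in a chosen subset and the Obscurer answers yes or no. The lie pattern of a candidate $y$ is the binary string whose $i$-th bit is $1$ iff the $i$-th answer is false for $y$; the Obscurer's answers must keep her number's lie pattern in $R$. The Seeker wins for $n$ if he has an adaptive strategy guaranteeing after finitely many questions that at most one $y\in\{1,\dots,n\}$ has lie pattern in $R$; "the Seeker wins" means he wins for every $n\ge1$. -}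

module Defs where

open import Data.Bool using (Bool; true; false; _xor_)
open import Data.List using (List; []; _∷_; _++_; [_])
open import Data.List.Relation.Unary.All using (All)
open import Data.List.Relation.Binary.Infix.Heterogeneous using (Infix)
open import Data.Fin using (Fin)
open import Data.Nat using (ℕ)
open import Relation.Binary.PropositionalEquality using (_≡_)
open import Relation.Nullary using (¬_)

BinStr : Set
BinStr = List Bool

_IsSubstringOf_ : BinStr → BinStr → Set
p IsSubstringOf w = Infix _≡_ p w

r : List BinStr → BinStr → Set
r S w = All (λ s → ¬ (s IsSubstringOf w)) S

-- A game position for numbers 1..n (represented as Fin n): the current
-- lie pattern of every candidate y.
Position : ℕ → Set
Position n = Fin n → BinStr

-- A question is a subset Q of {1..n} (Q y = true iff y ∈ Q); an answer
-- a : Bool (true = "yes").  The answer is false for y iff Q y ≠ a, i.e.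
-- the new lie bit of y is Q y xor a, appended at the end of its pattern.
update : ∀ {n} → Position n → (Fin n → Bool) → Bool → Position n
update pos Q a y = pos y ++ [ Q y xor a ]

AtMostOneAlive : (R : BinStr → Set) → ∀ {n} → Position n → Set
AtMostOneAlive R pos = ∀ y z → R (pos y) → R (pos z) → y ≡ z

-- Positions from which the Seeker has an adaptive strategy that
-- guarantees, after finitely many questions (the strategy tree is
-- well-founded), that at most one candidate has lie pattern in R,
-- whatever the answers.  (Answers that leave no candidate alive are not
-- legal for the Obscurer; they lead to a position satisfying
-- AtMostOneAlive anyway, so quantifying over both answers is harmless.)
data SeekerWinsFrom (R : BinStr → Set) {n : ℕ} : Position n → Set where
  done : ∀ {pos} → AtMostOneAlive R pos → SeekerWinsFrom R pos
  ask  : ∀ {pos} (Q : Fin n → Bool) →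
         (∀ a → SeekerWinsFrom R (update pos Q a)) → SeekerWinsFrom R pos

SeekerWinsFor : (R : BinStr → Set) → ℕ → Set
SeekerWinsFor R n = SeekerWinsFrom R {n} (λ _ → [])

SeekerWins : (R : BinStr → Set) → Set
SeekerWins R = ∀ n → 1 Data.Nat.≤ n → SeekerWinsFor R n

-- With two candidates the Obscurer can always answer so that both lie
-- patterns avoid a pattern c = e ∷ʳ l, where e = u ∷ʳ m, provided a pattern
-- ending in e stops ending in e after one more bit `not l`. She keeps both
-- patterns c-free and never lets both end in e: a bit `not l` never
-- completes c, and a bit l only completes it for a pattern ending in e.
-- Both ll and l(not l)l have this property, every string that is 00, 11 or
-- of length at least three contains one of them, and a common substring p
-- of s₁ and s₂ makes every p-free string an element of r {s₁, s₂}; so the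
-- Seeker cannot even win for n = 2.
module Submission where

open import Defs
open import Data.Bool using (Bool; true; false; not; _xor_)
open import Data.Bool.Properties using (_≟_)
open import Data.List using ([]; _∷_; length; _++_; [_]; _∷ʳ_)
open import Data.List.Properties using (∷ʳ-injective; ∷ʳ-injectiveʳ; ++-assoc; ++-identityʳ; ++-conicalʳ; ≡-dec)
open import Data.List.Relation.Unary.All using ([]; _∷_)
open import Data.List.Relation.Binary.Infix.Heterogeneous using (here; there)
import Data.List.Relation.Binary.Infix.Heterogeneous.Properties as Infix
open import Data.List.Relation.Binary.Prefix.Heterogeneous using (Prefix; []; _∷_)
open import Data.Fin using (zero; suc)
open import Data.Nat using (_≤_; s≤s; z≤n)
open import Data.Product using (∃; _×_; _,_; proj₁; proj₂)
open import Data.Sum using (_⊎_; inj₁; inj₂; [_,_]′)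
open import Relation.Binary.PropositionalEquality using (_≡_; _≢_; refl; sym; trans; cong)
open import Relation.Nullary using (¬_; Dec; yes; no)

_EndsWith_ : BinStr → BinStr → Set
w EndsWith u = ∃ λ v → w ≡ v ++ u

Avoids : BinStr → BinStr → Set
Avoids c w = ¬ c IsSubstringOf w

not-≢ : ∀ b → not b ≢ b
not-≢ false ()
not-≢ true ()

IsSubstringOf-trans : ∀ {p q w} → p IsSubstringOf q → q IsSubstringOf w → p IsSubstringOf w
IsSubstringOf-trans = Infix.trans trans

EndsWith-∷⁻ : ∀ {u x w} → (x ∷ w) EndsWith u → x ∷ w ≡ u ⊎ w EndsWith u
EndsWith-∷⁻ ([] , eq) = inj₁ eq
EndsWith-∷⁻ (_ ∷ v , refl) = inj₂ (v , refl)

endsWith? : ∀ w u → Dec (w EndsWith u)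
endsWith? w [] = yes (w , sym (++-identityʳ w))
endsWith? [] (_ ∷ _) = no λ { ([] , ()) ; (_ ∷ _ , ()) }
endsWith? (x ∷ w) u with ≡-dec _≟_ (x ∷ w) u | endsWith? w u
... | yes eq | _ = yes ([] , eq)
... | no _ | yes (v , eq) = yes (x ∷ v , cong (x ∷_) eq)
... | no ≢u | no ¬ends = no λ ends → [ ≢u , ¬ends ]′ (EndsWith-∷⁻ ends)

[]-¬EndsWith-∷ʳ : ∀ u m → ¬ [] EndsWith (u ∷ʳ m)
[]-¬EndsWith-∷ʳ u m (v , eq) with ++-conicalʳ u [ m ] (++-conicalʳ v (u ∷ʳ m) (sym eq))
... | ()

EndsWith-∷ʳ⁻ : ∀ {w b u c} → (w ∷ʳ b) EndsWith (u ∷ʳ c) → w EndsWith u × b ≡ c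
EndsWith-∷ʳ⁻ {w} {b} {u} {c} (v , eq)
  with eq′ , b≡c ← ∷ʳ-injective w (v ++ u) (trans eq (sym (++-assoc v u [ c ])))
  = (v , eq′) , b≡c

EndsWith-last-unique : ∀ {w u u′ a b} → w EndsWith (u ∷ʳ a) → w EndsWith (u′ ∷ʳ b) → a ≡ b
EndsWith-last-unique {u = u} {u′} {a} {b} (v , refl) (v′ , eq) =
  ∷ʳ-injectiveʳ (v ++ u) (v′ ++ u′) (trans (++-assoc v u [ a ]) (trans eq (sym (++-assoc v′ u′ [ b ]))))

Prefix-∷ʳ⁻ : ∀ {p : BinStr} w b → Prefix _≡_ p (w ∷ʳ b) → Prefix _≡_ p w ⊎ p ≡ w ∷ʳ b
Prefix-∷ʳ⁻ [] b [] = inj₁ []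
Prefix-∷ʳ⁻ [] b (refl ∷ []) = inj₂ refl
Prefix-∷ʳ⁻ (x ∷ w) b [] = inj₁ []
Prefix-∷ʳ⁻ (x ∷ w) b (refl ∷ pre) with Prefix-∷ʳ⁻ w b pre
... | inj₁ pre′ = inj₁ (refl ∷ pre′)
... | inj₂ eq = inj₂ (cong (x ∷_) eq)

IsSubstringOf-∷ʳ⁻ : ∀ {p} w b → p IsSubstringOf (w ∷ʳ b) → p IsSubstringOf w ⊎ (w ∷ʳ b) EndsWith p
IsSubstringOf-∷ʳ⁻ [] b (there inf) = inj₁ inf
IsSubstringOf-∷ʳ⁻ w b (here pre) with Prefix-∷ʳ⁻ w b pre
... | inj₁ pre′ = inj₁ (here pre′)
... | inj₂ eq = inj₂ ([] , sym eq)
IsSubstringOf-∷ʳ⁻ (x ∷ w) b (there inf) with IsSubstringOf-∷ʳ⁻ w b inf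
... | inj₁ inf′ = inj₁ (there inf′)
... | inj₂ (v , eq) = inj₂ (x ∷ v , cong (x ∷_) eq)

[]-Avoids-∷ʳ : ∀ u {l} → Avoids (u ∷ʳ l) []
[]-Avoids-∷ʳ [] (here ())
[]-Avoids-∷ʳ (_ ∷ _) (here ())

Avoids-∷ʳ : ∀ {u l w b} → Avoids (u ∷ʳ l) w → (w EndsWith u → b ≢ l) → Avoids (u ∷ʳ l) (w ∷ʳ b)
Avoids-∷ʳ {w = w} {b} avoids guard inf with IsSubstringOf-∷ʳ⁻ w b inf
... | inj₁ inf′ = avoids inf′
... | inj₂ ends = let ends′ , b≡l = EndsWith-∷ʳ⁻ ends in guard ends′ b≡l

ObscurerAvoids : BinStr → Set
ObscurerAvoids c = ¬ SeekerWinsFor (Avoids c) 2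

SeekerWinsFrom-mono : ∀ {R R′ : BinStr → Set} {n} {pos : Position n} →
  (∀ w → R′ w → R w) → SeekerWinsFrom R pos → SeekerWinsFrom R′ pos
SeekerWinsFrom-mono R′⊆R (done unique) = done λ y z alive-y alive-z → unique y z (R′⊆R _ alive-y) (R′⊆R _ alive-z)
SeekerWinsFrom-mono R′⊆R (ask Q next) = ask Q λ a → SeekerWinsFrom-mono R′⊆R (next a)

module _ (R : BinStr → Set) (Inv : BinStr → BinStr → Set)
         (alive : ∀ {w₀ w₁} → Inv w₀ w₁ → R w₀ × R w₁)
         (equal-bits : ∀ {w₀ w₁} → Inv w₀ w₁ → ∃ λ b → Inv (w₀ ∷ʳ b) (w₁ ∷ʳ b))
         (opposite-bits : ∀ {w₀ w₁} → Inv w₀ w₁ → ∃ λ b → Inv (w₀ ∷ʳ b) (w₁ ∷ʳ not b))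
         where

  -- Answer a appends the bits q₀ xor a and q₁ xor a: equal ones iff q₀ ≡ q₁.
  answer : ∀ {w₀ w₁} → Inv w₀ w₁ → ∀ q₀ q₁ → ∃ λ a → Inv (w₀ ∷ʳ (q₀ xor a)) (w₁ ∷ʳ (q₁ xor a))
  answer inv false false = equal-bits inv
  answer inv true true with equal-bits inv
  ... | false , inv′ = true , inv′
  ... | true , inv′ = false , inv′
  answer inv false true = opposite-bits inv
  answer inv true false with opposite-bits inv
  ... | false , inv′ = true , inv′
  ... | true , inv′ = false , inv′

  ¬SeekerWinsFrom-pair : (pos : Position 2) → Inv (pos zero) (pos (suc zero)) → ¬ SeekerWinsFrom R pos
  ¬SeekerWinsFrom-pair pos inv (done unique)
    with () ← unique zero (suc zero) (proj₁ (alive inv)) (proj₂ (alive inv))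
  ¬SeekerWinsFrom-pair pos inv (ask Q next) =
    let a , inv′ = answer inv (Q zero) (Q (suc zero)) in ¬SeekerWinsFrom-pair (update pos Q a) inv′ (next a)

module _ (u : BinStr) (m l : Bool)
         (self-overlap-free : ∀ {w} → w EndsWith (u ∷ʳ m) → ¬ (w ∷ʳ not l) EndsWith (u ∷ʳ m))
         where

  private
    e c : BinStr
    e = u ∷ʳ m
    c = e ∷ʳ l

    NotBothEnd : BinStr → BinStr → Set
    NotBothEnd w₀ w₁ = ¬ (w₀ EndsWith e × w₁ EndsWith e)

    Invariant : BinStr → BinStr → Set
    Invariant w₀ w₁ = Avoids c w₀ × Avoids c w₁ × NotBothEnd w₀ w₁

    Avoids-∷ʳ-not : ∀ {w} → Avoids c w → Avoids c (w ∷ʳ not l)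
    Avoids-∷ʳ-not avoids = Avoids-∷ʳ avoids λ _ → not-≢ l

    Avoids-∷ʳ-¬EndsWith : ∀ {w b} → Avoids c w → ¬ w EndsWith e → Avoids c (w ∷ʳ b)
    Avoids-∷ʳ-¬EndsWith avoids ¬ends = Avoids-∷ʳ avoids λ ends _ → ¬ends ends

    NotBothEnd-opposite : ∀ w₀ w₁ b → NotBothEnd (w₀ ∷ʳ b) (w₁ ∷ʳ not b)
    NotBothEnd-opposite _ _ b (ends₀ , ends₁) =
      not-≢ b (trans (proj₂ (EndsWith-∷ʳ⁻ ends₁)) (sym (proj₂ (EndsWith-∷ʳ⁻ ends₀))))

    equal-bits : ∀ {w₀ w₁} → Invariant w₀ w₁ → ∃ λ b → Invariant (w₀ ∷ʳ b) (w₁ ∷ʳ b)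
    equal-bits {w₀} {w₁} (avoids₀ , avoids₁ , _) with endsWith? w₀ e | endsWith? w₁ e
    ... | yes ends₀ | _ = not l , Avoids-∷ʳ-not avoids₀ , Avoids-∷ʳ-not avoids₁ ,
                          λ both → self-overlap-free ends₀ (proj₁ both)
    ... | no _ | yes ends₁ = not l , Avoids-∷ʳ-not avoids₀ , Avoids-∷ʳ-not avoids₁ ,
                             λ both → self-overlap-free ends₁ (proj₂ both)
    ... | no ¬ends₀ | no ¬ends₁ = not m , Avoids-∷ʳ-¬EndsWith avoids₀ ¬ends₀ , Avoids-∷ʳ-¬EndsWith avoids₁ ¬ends₁ ,
                                  λ both → not-≢ m (proj₂ (EndsWith-∷ʳ⁻ (proj₁ both)))

    opposite-bits : ∀ {w₀ w₁} → Invariant w₀ w₁ → ∃ λ b → Invariant (w₀ ∷ʳ b) (w₁ ∷ʳ not b)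
    opposite-bits {w₀} {w₁} (avoids₀ , avoids₁ , notBoth) with endsWith? w₀ e
    ... | yes ends₀ = not l , Avoids-∷ʳ-not avoids₀ ,
                      Avoids-∷ʳ-¬EndsWith avoids₁ (λ ends₁ → notBoth (ends₀ , ends₁)) ,
                      NotBothEnd-opposite w₀ w₁ (not l)
    ... | no ¬ends₀ = l , Avoids-∷ʳ-¬EndsWith avoids₀ ¬ends₀ , Avoids-∷ʳ-not avoids₁ ,
                      NotBothEnd-opposite w₀ w₁ l

  ObscurerAvoids-self-overlap-free : ObscurerAvoids (u ∷ʳ m ∷ʳ l)
  ObscurerAvoids-self-overlap-free =
    ¬SeekerWinsFrom-pair (Avoids c) Invariant (λ inv → proj₁ inv , proj₁ (proj₂ inv)) equal-bits opposite-bits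
      (λ _ → []) ([]-Avoids-∷ʳ e , []-Avoids-∷ʳ e , λ both → []-¬EndsWith-∷ʳ u m (proj₁ both))

ObscurerAvoids-ll : ∀ l → ObscurerAvoids (l ∷ l ∷ [])
ObscurerAvoids-ll l = ObscurerAvoids-self-overlap-free [] l l
  λ _ ends → not-≢ l (proj₂ (EndsWith-∷ʳ⁻ {u = []} ends))

ObscurerAvoids-lnl : ∀ l → ObscurerAvoids (l ∷ not l ∷ l ∷ [])
ObscurerAvoids-lnl l = ObscurerAvoids-self-overlap-free [ l ] (not l) l
  λ ends ends′ → not-≢ l (EndsWith-last-unique {u = [ l ]} {u′ = []} ends (proj₁ (EndsWith-∷ʳ⁻ {u = [ l ]} ends′)))

three-letters-contain-ObscurerAvoids : ∀ x y z → ∃ λ c → ObscurerAvoids c × c IsSubstringOf (x ∷ y ∷ z ∷ [])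
three-letters-contain-ObscurerAvoids false false _ = _ , ObscurerAvoids-ll false , here (refl ∷ refl ∷ [])
three-letters-contain-ObscurerAvoids true true _ = _ , ObscurerAvoids-ll true , here (refl ∷ refl ∷ [])
three-letters-contain-ObscurerAvoids _ false false = _ , ObscurerAvoids-ll false , there (here (refl ∷ refl ∷ []))
three-letters-contain-ObscurerAvoids _ true true = _ , ObscurerAvoids-ll true , there (here (refl ∷ refl ∷ []))
three-letters-contain-ObscurerAvoids false true false = _ , ObscurerAvoids-lnl false , here (refl ∷ refl ∷ refl ∷ [])
three-letters-contain-ObscurerAvoids true false true = _ , ObscurerAvoids-lnl true , here (refl ∷ refl ∷ refl ∷ [])

contains-ObscurerAvoids : ∀ p → p ≡ false ∷ false ∷ [] ⊎ p ≡ true ∷ true ∷ [] ⊎ 3 ≤ length p →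
  ∃ λ c → ObscurerAvoids c × c IsSubstringOf p
contains-ObscurerAvoids _ (inj₁ refl) = _ , ObscurerAvoids-ll false , here (refl ∷ refl ∷ [])
contains-ObscurerAvoids _ (inj₂ (inj₁ refl)) = _ , ObscurerAvoids-ll true , here (refl ∷ refl ∷ [])
contains-ObscurerAvoids (x ∷ y ∷ z ∷ _) (inj₂ (inj₂ (s≤s (s≤s (s≤s _))))) =
  let c , avoidable , c⊆xyz = three-letters-contain-ObscurerAvoids x y z
  in c , avoidable , IsSubstringOf-trans c⊆xyz (here (refl ∷ refl ∷ refl ∷ []))

¬SeekerWins-common-ObscurerAvoids : ∀ {s₁ s₂ c} → ObscurerAvoids c → c IsSubstringOf s₁ → c IsSubstringOf s₂ →
  ¬ SeekerWins (r (s₁ ∷ s₂ ∷ []))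
¬SeekerWins-common-ObscurerAvoids avoidable c⊆s₁ c⊆s₂ wins = avoidable (SeekerWinsFrom-mono avoids⇒r (wins 2 (s≤s z≤n)))
  where
  avoids⇒r : ∀ w → Avoids _ w → r _ w
  avoids⇒r w avoids = (λ s₁⊆w → avoids (IsSubstringOf-trans c⊆s₁ s₁⊆w))
                    ∷ (λ s₂⊆w → avoids (IsSubstringOf-trans c⊆s₂ s₂⊆w)) ∷ []

lemma2 : (s₁ s₂ : BinStr) → s₁ ≢ [] → s₂ ≢ [] → s₁ ≢ s₂ →
    SeekerWins (r (s₁ ∷ s₂ ∷ [])) →
    ¬ (∃ λ p → (p ≡ false ∷ false ∷ [] ⊎ p ≡ true ∷ true ∷ [] ⊎ 3 ≤ length p)
               × p IsSubstringOf s₁ × p IsSubstringOf s₂)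
lemma2 s₁ s₂ _ _ _ wins (p , shape , p⊆s₁ , p⊆s₂) =
  let c , avoidable , c⊆p = contains-ObscurerAvoids p shape
  in ¬SeekerWins-common-ObscurerAvoids avoidable (IsSubstringOf-trans c⊆p p⊆s₁) (IsSubstringOf-trans c⊆p p⊆s₂) wins
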